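{- Let $X,Y$ be strings and $k\ge0$ an integer. Consider the following procedure: set $d'_0:=0$; for $i=0,1,\ldots,k$: set $d_i:=d'_i+\max_{\delta=-k}^{k}\widetilde{\mathrm{LCE}}_k^{X,Y}(d'_i,d'_i+\delta)$ and $d'_{i+1}:=\min(|X|,d_i+1)$; finally return YES if $||X|-|Y||\le k$ and $d_k=|X|$, and NO otherwise. Here each value $\widetilde{\mathrm{LCE}}_k^{X,Y}(\cdot,\cdot)$ may be an arbitrary value satisfying its defining bounds. Then the procedure returns YES if $\mathsf{ED}(X,Y)\le k$ and returns NO if $\mathsf{ED}(X,Y)>(3k+5)k$.
   Context: Strings are indexed from $0$; $X[a\mathinner{.\,.} b)=X[a]\cdots X[b-1]$. $\mathsf{HD}$ is Hamming distance and $\mathsf{ED}$ is edit distance (insertions, deletions, substitutions). For integers $x\in[0\mathinner{.\,.}|X|]$, $y\in[0\mathinner{.\,.}|Y|]$, $\mathrm{LCE}_k^{X,Y}(x,y)$ is the largest integer $\ell\le\min(|X|-x,|Y|-y)$ with $\mathsf{HD}(X[x\mathinner{.\,.} x+\ell),Y[y\mathinner{.\,.} y+\ell))\le k$; if $x\notin[0\mathinner{.\,.}|X|]$ or $y\notin[0\mathinner{.\,.}|Y|]$ it is $0$. $\widetilde{\mathrm{LCE}}_k^{X,Y}(x,y)$ denotes any value $v$ with $\mathrm{LCE}_0^{X,Y}(x,y)\le v\le\mathrm{LCE}_k^{X,Y}(x,y)$. -}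

module Defs where

open import Data.Nat using (ℕ; zero; suc; _+_; _*_; _∸_; _≤_; _<_; _⊔_; _⊓_; _≤ᵇ_; ∣_-_∣; _≟_)
open import Data.Integer as ℤ using (ℤ; +_; -[1+_])
open import Data.List using (List; []; _∷_; length; take; drop; map; foldr; upTo)
open import Data.Bool using (Bool; true; false; _∧_; if_then_else_)
open import Relation.Binary.Definitions using (DecidableEquality)
open import Relation.Nullary using (yes; no)
open import Relation.Nullary.Decidable using (does)

module _ {A : Set} (_≟A_ : DecidableEquality A) where

  HD : List A → List A → ℕ
  HD (x ∷ xs) (y ∷ ys) = (if does (x ≟A y) then 0 else 1) + HD xs ys
  HD _ _ = 0

  ED : List A → List A → ℕ
  ED [] ys = length ys
  ED (x ∷ xs) [] = suc (length xs)
  ED (x ∷ xs) (y ∷ ys) =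
    ((ED xs ys + (if does (x ≟A y) then 0 else 1)) ⊓ suc (ED xs (y ∷ ys))) ⊓ suc (ED (x ∷ xs) ys)

  sub : List A → ℕ → ℕ → List A
  sub X a ℓ = take ℓ (drop a X)

  lceSearch : ℕ → List A → List A → ℕ → ℕ → ℕ → ℕ
  lceSearch k X Y x y zero = zero
  lceSearch k X Y x y (suc ℓ) =
    if HD (sub X x (suc ℓ)) (sub Y y (suc ℓ)) ≤ᵇ k then suc ℓ else lceSearch k X Y x y ℓ

  -- LCE_k^{X,Y}(x,y), with x ∈ ℕ and y ∈ ℤ; 0 when x ∉ [0..|X|] or y ∉ [0..|Y|]
  LCE : ℕ → List A → List A → ℕ → ℤ → ℕ
  LCE k X Y x -[1+ _ ] = 0
  LCE k X Y x (+ y) =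
    if (x ≤ᵇ length X) ∧ (y ≤ᵇ length Y)
    then lceSearch k X Y x y ((length X ∸ x) ⊓ (length Y ∸ y))
    else 0

  -- An oracle answering the i-th round's queries with approximate LCE values:
  -- any value v with LCE_0(x,y) ≤ v ≤ LCE_k(x,y).
  ValidOracle : ℕ → List A → List A → (ℕ → ℕ → ℤ → ℕ) → Set
  ValidOracle k X Y O = ∀ i x y → LCE 0 X Y x y ≤ O i x y × O i x y ≤ LCE k X Y x y
    where open import Data.Product using (_×_)

  -- max_{δ = -k}^{k} O i x (x + δ)
  maxDelta : ℕ → (ℕ → ℕ → ℤ → ℕ) → ℕ → ℕ → ℕ
  maxDelta k O i x =
    foldr _⊔_ 0 (map (λ j → O i x ((+ x ℤ.+ + j) ℤ.- + k)) (upTo (suc (2 * k))))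

  d′ : ℕ → List A → (ℕ → ℕ → ℤ → ℕ) → ℕ → ℕ
  dd : ℕ → List A → (ℕ → ℕ → ℤ → ℕ) → ℕ → ℕ
  d′ k X O zero = 0
  d′ k X O (suc i) = length X ⊓ (dd k X O i + 1)
  dd k X O i = d′ k X O i + maxDelta k O i (d′ k X O i)

  procedure : ℕ → List A → List A → (ℕ → ℕ → ℤ → ℕ) → Bool
  procedure k X Y O = (∣ length X - length Y ∣ ≤ᵇ k) ∧ does (dd k X O k ≟ length X)

module Submission where

-- Write E x y = ED(X[x..), Y[y..)); (x, y) is a band point when |x − y| ≤ k.
-- Round i queries the 2k + 1 band points (d′ᵢ, y) and jumps by the largest
-- answer.
-- • Completeness.  Cutting an optimal alignment after a prefix of X (`cut`)
--   leaves suffixes of cost ≤ ED − |offset|, and strictly less unless the two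
--   prefixes coincide.  As every answer is ≥ LCE₀, an unfinished round stops
--   before a mismatch of the current optimal diagonal and so uses up one unit
--   of budget (`round`); hence k + 1 unfinished rounds cannot happen.
-- • Soundness.  The largest answer is realised by k-close substrings on a band
--   diagonal (`reach-extension`), aligned at cost ≤ k; passing to the next
--   round costs ≤ 2k + 1 (`E-transition`, from E being 1-Lipschitz), the start
--   ≤ k and the final jump to the end of Y ≤ 2k, in total (3k + 5)k.
-- The file develops facts on ℕ-distances and list maxima, then on edit and
-- Hamming distance and the LCE search, and finally analyses the procedure.

open import Data.Bool using (true; false; if_then_else_; T)
open import Data.Bool.Properties using (T-≡)
open import Data.Empty using (⊥-elim)
open import Data.Integer as ℤ using (ℤ; _⊖_)
open import Data.Integer.Properties as ℤ using (⊖-≥; ⊖-<; [+m]-[+n]≡m⊖n)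
open import Data.List using (List; []; _∷_; length; take; drop; map; foldr; upTo)
open import Data.List.Membership.Propositional using (_∈_)
open import Data.List.Membership.Propositional.Properties using (∈-upTo⁺; ∈-upTo⁻)
open import Data.List.Properties using (length-drop; drop-all; drop-drop; length-take)
open import Data.List.Relation.Unary.Any using (here; there)
open import Data.Nat
  using (ℕ; zero; suc; _+_; _*_; _∸_; _≤_; _<_; _⊔_; _⊓_; _≤ᵇ_; _≤?_; ∣_-_∣; _≟_; z≤n; s≤s)
open import Data.Nat.Properties
open import Data.Nat.Tactic.RingSolver using (solve-∀)
open import Data.Product using (_×_; _,_; ∃; proj₁; proj₂)
open import Data.Sum using (_⊎_; inj₁; inj₂)
open import Data.Unit using (tt)
open import Function.Bundles using (Equivalence)
open import Relation.Binary.Definitions using (DecidableEquality)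
open import Relation.Binary.PropositionalEquality
  using (_≡_; _≢_; refl; sym; trans; cong; cong₂; subst; subst₂; module ≡-Reasoning)
open import Relation.Nullary using (yes; no)
open import Relation.Nullary.Decidable using (does; dec-true; dec-false)

open import Defs

fold⊔-upper : (f : ℕ → ℕ) (l : List ℕ) {j : ℕ} → j ∈ l → f j ≤ foldr _⊔_ 0 (map f l)
fold⊔-upper f (x ∷ l) (here refl) = m≤m⊔n (f x) _
fold⊔-upper f (x ∷ l) (there p) = ≤-trans (fold⊔-upper f l p) (m≤n⊔m (f x) _)

fold⊔-attained : (f : ℕ → ℕ) (l : List ℕ) →
  foldr _⊔_ 0 (map f l) ≡ 0 ⊎ ∃ λ j → j ∈ l × foldr _⊔_ 0 (map f l) ≡ f j
fold⊔-attained f [] = inj₁ refl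
fold⊔-attained f (x ∷ l) with ⊔-sel (f x) (foldr _⊔_ 0 (map f l))
... | inj₁ e = inj₂ (x , here refl , e)
... | inj₂ e with fold⊔-attained f l
...   | inj₁ e₀ = inj₁ (trans e e₀)
...   | inj₂ (j , j∈l , e₁) = inj₂ (j , there j∈l , trans e e₁)

⊓₃-elim : (P : ℕ → Set) (a b c : ℕ) → P a → P b → P c → P ((a ⊓ b) ⊓ c)
⊓₃-elim P a b c pa pb pc with ⊓-sel (a ⊓ b) c
... | inj₂ e rewrite e = pc
... | inj₁ e rewrite e with ⊓-sel a b
...   | inj₁ e′ rewrite e′ = pa
...   | inj₂ e′ rewrite e′ = pb

band-intro : ∀ {x y k} → x ≤ y + k → y ≤ x + k → ∣ x - y ∣ ≤ k
band-intro {x} {y} {k} x≤ y≤ with ∣m-n∣≡[m∸n]∨[n∸m] x y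
... | inj₁ e = subst (_≤ k) (sym e) (m≤n+o⇒m∸n≤o x y x≤)
... | inj₂ e = subst (_≤ k) (sym e) (m≤n+o⇒m∸n≤o y x y≤)

band-left : ∀ x y {k} → ∣ x - y ∣ ≤ k → x ≤ y + k
band-left x y {k} d = ≤-trans (m≤n+∣m-n∣ x y) (+-monoʳ-≤ y d)

band-sym : ∀ x y {k} → ∣ x - y ∣ ≤ k → ∣ y - x ∣ ≤ k
band-sym x y d = subst (_≤ _) (∣-∣-comm x y) d

band-right : ∀ x y {k} → ∣ x - y ∣ ≤ k → y ≤ x + k
band-right x y d = band-left y x (band-sym x y d)

-- The queries of one round are the offsets y = x + j − k, j ∈ [0, 2k]; these
-- are exactly the points of the band of width k around x.
offset⇒band : ∀ {x y j k} → x + j ≡ y + k → j ≤ k + k → ∣ x - y ∣ ≤ k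
offset⇒band {x} {y} {j} {k} e j≤ = band-intro x≤ (+-cancelʳ-≤ k y (x + k) y+k≤)
  where
  x≤ : x ≤ y + k
  x≤ = ≤-trans (m≤m+n x j) (≤-reflexive e)
  y+k≤ : y + k ≤ x + k + k
  y+k≤ = ≤-trans (≤-reflexive (sym e)) (≤-trans (+-monoʳ-≤ x j≤) (≤-reflexive (sym (+-assoc x k k))))

band⇒offset : ∀ x y {k} → ∣ x - y ∣ ≤ k → x + (y + k ∸ x) ≡ y + k × y + k ∸ x ≤ k + k
band⇒offset x y {k} d =
  m+[n∸m]≡n (band-left x y d) ,
  m≤n+o⇒m∸n≤o (y + k) x (≤-trans (+-monoˡ-≤ k (band-right x y d)) (≤-reflexive (+-assoc x k k)))

+⊖-cancel : ∀ y n → (y + n) ⊖ n ≡ ℤ.+ y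
+⊖-cancel y n = trans (⊖-≥ (m≤n+m n y)) (cong ℤ.+_ (m+n∸n≡m y n))

⊖≡+⇒ : ∀ {m n y} → m ⊖ n ≡ ℤ.+ y → m ≡ y + n
⊖≡+⇒ {m} {n} {y} e with n ≤? m
... | yes n≤m = trans (sym (m∸n+n≡m n≤m)) (cong (_+ n) (ℤ.+-injective (trans (sym (⊖-≥ n≤m)) e)))
... | no n≰m = ⊥-elim (negative≢+ (m<n⇒0<n∸m (≰⇒> n≰m)) (trans (sym (⊖-< (≰⇒> n≰m))) e))
  where
  negative≢+ : ∀ {d} → 0 < d → ℤ.- ℤ.+ d ≢ ℤ.+ y
  negative≢+ {suc d} _ ()

∣suc-n-n∣ : ∀ n → ∣ suc n - n ∣ ≡ 1
∣suc-n-n∣ zero = refl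
∣suc-n-n∣ (suc n) = ∣suc-n-n∣ n

∣-∣-sucˡ : ∀ m n → ∣ suc m - n ∣ ≤ suc ∣ m - n ∣
∣-∣-sucˡ m n = subst (λ d → ∣ suc m - n ∣ ≤ d + ∣ m - n ∣) (∣suc-n-n∣ m) (∣-∣-triangle (suc m) m n)

∣-∣-predˡ : ∀ m n → ∣ m - n ∣ ≤ suc ∣ suc m - n ∣
∣-∣-predˡ m n =
  subst (λ d → ∣ m - n ∣ ≤ d + ∣ suc m - n ∣) (trans (∣-∣-comm m (suc m)) (∣suc-n-n∣ m))
    (∣-∣-triangle m (suc m) n)

∣-∣-suc-mono : ∀ {y′ y} → y′ ≤ y → ∣ y - y′ ∣ ≤ ∣ suc y - y′ ∣
∣-∣-suc-mono {zero} {y} z≤n = ≤-trans (≤-reflexive (∣-∣-identityʳ y)) (n≤1+n y)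
∣-∣-suc-mono {suc y′} {suc y} (s≤s y′≤y) = ∣-∣-suc-mono y′≤y

∣-∣-shift : ∀ x y a → ∣ x + a - y + a ∣ ≡ ∣ x - y ∣
∣-∣-shift x y a = trans (cong₂ ∣_-_∣ (+-comm x a) (+-comm y a)) (∣m+n-m+o∣≡∣n-o∣ a x y)

∣-∣-+ : ∀ x y a b → ∣ x + a - y + b ∣ ≤ ∣ x - y ∣ + ∣ a - b ∣
∣-∣-+ x y a b = begin
  ∣ x + a - y + b ∣                   ≤⟨ ∣-∣-triangle (x + a) (y + a) (y + b) ⟩
  ∣ x + a - y + a ∣ + ∣ y + a - y + b ∣ ≡⟨ cong₂ _+_ (∣-∣-shift x y a) (∣m+n-m+o∣≡∣n-o∣ y a b) ⟩
  ∣ x - y ∣ + ∣ a - b ∣                 ∎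
  where open ≤-Reasoning

unit-steps⇒lipschitz : (f : ℕ → ℕ) → (∀ n → f n ≤ suc (f (suc n))) →
  (∀ n → f (suc n) ≤ suc (f n)) → ∀ m n → f m ≤ f n + ∣ m - n ∣
unit-steps⇒lipschitz f down up zero zero = m≤m+n (f 0) 0
unit-steps⇒lipschitz f down up zero (suc n) = begin
  f 0                ≤⟨ unit-steps⇒lipschitz f down up 0 n ⟩
  f n + n            ≤⟨ +-monoˡ-≤ n (down n) ⟩
  suc (f (suc n)) + n ≡⟨ +-suc (f (suc n)) n ⟨
  f (suc n) + suc n  ∎
  where open ≤-Reasoning
unit-steps⇒lipschitz f down up (suc m) zero = begin
  f (suc m)          ≤⟨ up m ⟩
  suc (f m)          ≤⟨ s≤s (unit-steps⇒lipschitz f down up m 0) ⟩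
  suc (f 0 + ∣ m - 0 ∣) ≡⟨ cong (λ d → suc (f 0 + d)) (∣-∣-identityʳ m) ⟩
  suc (f 0 + m)      ≡⟨ +-suc (f 0) m ⟨
  f 0 + suc m        ∎
  where open ≤-Reasoning
unit-steps⇒lipschitz f down up (suc m) (suc n) =
  unit-steps⇒lipschitz (λ i → f (suc i)) (λ i → down (suc i)) (λ i → up (suc i)) m n

module _ {A : Set} (_≟A_ : DecidableEquality A) where

  ed : List A → List A → ℕ
  ed = ED _≟A_

  hd : List A → List A → ℕ
  hd = HD _≟A_

  mis : A → A → ℕ
  mis s t = if does (s ≟A t) then 0 else 1

  mis≤1 : ∀ s t → mis s t ≤ 1
  mis≤1 s t with does (s ≟A t)
  ... | true = z≤n
  ... | false = ≤-refl

  mis-refl : ∀ s → mis s s ≡ 0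
  mis-refl s rewrite dec-true (s ≟A s) refl = refl

  hd-refl : ∀ S → hd S S ≡ 0
  hd-refl [] = refl
  hd-refl (s ∷ S) rewrite mis-refl s = hd-refl S

  hd-take-mono : ∀ {a b} S T → a ≤ b → hd (take a S) (take a T) ≤ hd (take b S) (take b T)
  hd-take-mono {zero} S T _ = z≤n
  hd-take-mono {suc a} {suc b} [] T _ = z≤n
  hd-take-mono {suc a} {suc b} (s ∷ S) [] _ = z≤n
  hd-take-mono {suc a} {suc b} (s ∷ S) (t ∷ T) (s≤s a≤b) =
    +-monoʳ-≤ (mis s t) (hd-take-mono S T a≤b)

  ed-match : ∀ s t S T → ed (s ∷ S) (t ∷ T) ≤ ed S T + mis s t
  ed-match s t S T = ≤-trans (m⊓n≤m _ _) (m⊓n≤m _ _)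

  ed-delete : ∀ s t S T → ed (s ∷ S) (t ∷ T) ≤ suc (ed S (t ∷ T))
  ed-delete s t S T = ≤-trans (m⊓n≤m _ _) (m⊓n≤n _ _)

  ed-insert : ∀ s t S T → ed (s ∷ S) (t ∷ T) ≤ suc (ed (s ∷ S) T)
  ed-insert s t S T = m⊓n≤n _ _

  ed-nilʳ : ∀ S → ed S [] ≡ length S
  ed-nilʳ [] = refl
  ed-nilʳ (s ∷ S) = refl

  ed-dropˡ : ∀ S T → ed S T ≤ suc (ed (drop 1 S) T)
  ed-dropˡ [] T = n≤1+n _
  ed-dropˡ (s ∷ S) [] rewrite ed-nilʳ S = ≤-refl
  ed-dropˡ (s ∷ S) (t ∷ T) = ed-delete s t S T

  ed-dropʳ : ∀ S T → ed S T ≤ suc (ed S (drop 1 T))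
  ed-dropʳ S [] = n≤1+n _
  ed-dropʳ [] (t ∷ T) = ≤-refl
  ed-dropʳ (s ∷ S) (t ∷ T) = ed-insert s t S T

  ed-drop-both : ∀ S T → ed S T ≤ suc (ed (drop 1 S) (drop 1 T))
  ed-drop-both [] T = ed-dropʳ [] T
  ed-drop-both (s ∷ S) [] rewrite ed-nilʳ S = ≤-refl
  ed-drop-both (s ∷ S) (t ∷ T) =
    ≤-trans (ed-match s t S T) (≤-trans (+-monoʳ-≤ (ed S T) (mis≤1 s t)) (≤-reflexive (+-comm (ed S T) 1)))

  ed-undropʳ : ∀ S T → ed S (drop 1 T) ≤ suc (ed S T)
  ed-undropʳ S [] = n≤1+n _
  ed-undropʳ [] (t ∷ T) = m≤n⇒m≤1+n (n≤1+n _)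
  ed-undropʳ (s ∷ S) (t ∷ T) =
    ⊓₃-elim (λ n → ed (s ∷ S) T ≤ suc n) _ _ _
      (≤-trans (ed-dropˡ (s ∷ S) T) (s≤s (m≤m+n _ _)))
      (≤-trans (ed-dropˡ (s ∷ S) T) (s≤s (ed-undropʳ S (t ∷ T))))
      (m≤n⇒m≤1+n (n≤1+n _))

  ed-≤-prefix-hd : ∀ v S T → v ≤ length S → v ≤ length T →
    ed S T ≤ ed (drop v S) (drop v T) + hd (take v S) (take v T)
  ed-≤-prefix-hd zero S T _ _ = m≤m+n _ _
  ed-≤-prefix-hd (suc v) (s ∷ S) (t ∷ T) (s≤s v≤S) (s≤s v≤T) = begin
    ed (s ∷ S) (t ∷ T) ≤⟨ ed-match s t S T ⟩
    ed S T + mis s t   ≤⟨ +-monoˡ-≤ (mis s t) (ed-≤-prefix-hd v S T v≤S v≤T) ⟩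
    (E + H) + mis s t  ≡⟨ +-assoc E H (mis s t) ⟩
    E + (H + mis s t)  ≡⟨ cong (E +_) (+-comm H (mis s t)) ⟩
    E + (mis s t + H)  ∎
    where
    open ≤-Reasoning
    E = ed (drop v S) (drop v T)
    H = hd (take v S) (take v T)

  -- A cut of an alignment of S and T of cost n after the first a characters
  -- of S: a position b in T such that the suffixes S[a..), T[b..) cost at most
  -- n − |a − b|, and strictly less than n unless the a-prefixes coincide.
  record Cut (S T : List A) (n a : ℕ) : Set where
    field
      b : ℕ
      b≤ : b ≤ length T
      bound : ed (drop a S) (drop b T) + ∣ a - b ∣ ≤ n
      strict : take a S ≢ take a T → ed (drop a S) (drop b T) < n

  cut-match : ∀ s t S T {a} → Cut S T (ed S T) a → Cut (s ∷ S) (t ∷ T) (ed S T + mis s t) (suc a)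
  cut-match s t S T {a} c = record
    { b = suc b ; b≤ = s≤s b≤ ; bound = ≤-trans bound (m≤m+n _ _) ; strict = strict′ }
    where
    open Cut c
    strict′ : s ∷ take a S ≢ t ∷ take a T → ed (drop a S) (drop b T) < ed S T + mis s t
    strict′ ne with s ≟A t
    ... | yes refl = ≤-trans (strict (λ e → ne (cong (s ∷_) e))) (m≤m+n _ 0)
    ... | no _ = ≤-trans (s≤s (m+n≤o⇒m≤o _ bound)) (≤-reflexive (+-comm 1 (ed S T)))

  cut-delete : ∀ s t S T {n a} → Cut S (t ∷ T) n a → Cut (s ∷ S) (t ∷ T) (suc n) (suc a)
  cut-delete s t S T {n} {a} c = record
    { b = b ; b≤ = b≤ ; bound = bound′ ; strict = λ _ → s≤s (m+n≤o⇒m≤o _ bound) }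
    where
    open Cut c
    E = ed (drop a S) (drop b (t ∷ T))
    bound′ : E + ∣ suc a - b ∣ ≤ suc n
    bound′ = begin
      E + ∣ suc a - b ∣   ≤⟨ +-monoʳ-≤ E (∣-∣-sucˡ a b) ⟩
      E + suc ∣ a - b ∣   ≡⟨ +-suc E _ ⟩
      suc (E + ∣ a - b ∣) ≤⟨ s≤s bound ⟩
      suc n               ∎
      where open ≤-Reasoning

  cut-insert : ∀ s t S T {n a} → Cut (s ∷ S) T n (suc a) → Cut (s ∷ S) (t ∷ T) (suc n) (suc a)
  cut-insert s t S T {n} {a} c = record
    { b = suc b ; b≤ = s≤s b≤ ; bound = bound′ ; strict = λ _ → s≤s (m+n≤o⇒m≤o _ bound) }
    where
    open Cut c
    E = ed (drop a S) (drop b T)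
    bound′ : E + ∣ a - b ∣ ≤ suc n
    bound′ = begin
      E + ∣ a - b ∣           ≤⟨ +-monoʳ-≤ E (∣-∣-predˡ a b) ⟩
      E + suc ∣ suc a - b ∣   ≡⟨ +-suc E _ ⟩
      suc (E + ∣ suc a - b ∣) ≤⟨ s≤s bound ⟩
      suc n                   ∎
      where open ≤-Reasoning

  cut : ∀ S T a → a ≤ length S → Cut S T (ed S T) a
  cut S T zero _ = record
    { b = 0 ; b≤ = z≤n ; bound = ≤-reflexive (+-identityʳ _) ; strict = λ ne → ⊥-elim (ne refl) }
  cut (s ∷ S) [] (suc a) (s≤s a≤S) = record
    { b = 0 ; b≤ = z≤n ; bound = ≤-reflexive bound′ ; strict = λ _ → s≤s rest≤ }
    where
    rest : ed (drop a S) [] ≡ length S ∸ a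
    rest = trans (ed-nilʳ (drop a S)) (length-drop a S)
    bound′ : ed (drop a S) [] + suc a ≡ suc (length S)
    bound′ = trans (cong (_+ suc a) rest) (trans (+-suc _ a) (cong suc (m∸n+n≡m a≤S)))
    rest≤ : ed (drop a S) [] ≤ length S
    rest≤ = subst (_≤ length S) (sym rest) (m∸n≤m (length S) a)
  cut (s ∷ S) (t ∷ T) (suc a) (s≤s a≤S) =
    ⊓₃-elim (λ n → Cut (s ∷ S) (t ∷ T) n (suc a)) _ _ _
      (cut-match s t S T (cut S T a a≤S))
      (cut-delete s t S T (cut S (t ∷ T) a a≤S))
      (cut-insert s t S T (cut (s ∷ S) T (suc a) (s≤s a≤S)))

  length-diff≤ed : ∀ S T → ∣ length S - length T ∣ ≤ ed S T
  length-diff≤ed S T = begin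
    ∣ length S - length T ∣           ≤⟨ ∣-∣-triangle (length S) b (length T) ⟩
    ∣ length S - b ∣ + ∣ b - length T ∣ ≡⟨ +-comm ∣ length S - b ∣ ∣ b - length T ∣ ⟩
    ∣ b - length T ∣ + ∣ length S - b ∣ ≡⟨ cong (_+ ∣ length S - b ∣) rest ⟨
    ed [] (drop b T) + ∣ length S - b ∣ ≡⟨ cong (λ R → ed R (drop b T) + ∣ length S - b ∣) S-consumed ⟨
    ed (drop (length S) S) (drop b T) + ∣ length S - b ∣
                                      ≤⟨ bound ⟩
    ed S T ∎
    where
    open ≤-Reasoning
    open Cut (cut S T (length S) ≤-refl)
    S-consumed : drop (length S) S ≡ []
    S-consumed = drop-all (length S) S ≤-refl
    rest : ed [] (drop b T) ≡ ∣ b - length T ∣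
    rest = trans (length-drop b T) (sym (m≤n⇒∣m-n∣≡n∸m b≤))

  module Search (k : ℕ) (X Y : List A) (x y : ℕ) where

    search : ℕ → ℕ
    search = lceSearch _≟A_ k X Y x y

    close : ℕ → Set
    close ℓ = hd (sub _≟A_ X x ℓ) (sub _≟A_ Y y ℓ) ≤ k

    search-≤ : ∀ m → search m ≤ m
    search-≤ zero = z≤n
    search-≤ (suc m) with hd (sub _≟A_ X x (suc m)) (sub _≟A_ Y y (suc m)) ≤ᵇ k
    ... | true = ≤-refl
    ... | false = m≤n⇒m≤1+n (search-≤ m)

    search-close : ∀ m → close (search m)
    search-close zero = z≤n
    search-close (suc m) with hd (sub _≟A_ X x (suc m)) (sub _≟A_ Y y (suc m)) ≤ᵇ k in eq
    ... | true = ≤ᵇ⇒≤ _ _ (subst T (sym eq) tt)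
    ... | false = search-close m

    search-max : ∀ m ℓ → ℓ ≤ m → close ℓ → ℓ ≤ search m
    search-max zero ℓ ℓ≤m _ = ℓ≤m
    search-max (suc m) ℓ ℓ≤m cl with hd (sub _≟A_ X x (suc m)) (sub _≟A_ Y y (suc m)) ≤ᵇ k in eq
    ... | true = ℓ≤m
    ... | false with m≤n⇒m<n∨m≡n ℓ≤m
    ...   | inj₁ ℓ<sm = search-max m ℓ (≤-pred ℓ<sm) cl
    ...   | inj₂ refl = ⊥-elim (subst T eq (≤⇒≤ᵇ cl))

  LCE-cases : ∀ k X Y x y → LCE _≟A_ k X Y x (ℤ.+ y) ≡ 0 ⊎
    (x ≤ length X × y ≤ length Y ×
     LCE _≟A_ k X Y x (ℤ.+ y) ≡ Search.search k X Y x y ((length X ∸ x) ⊓ (length Y ∸ y)))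
  LCE-cases k X Y x y with x ≤ᵇ length X in ex | y ≤ᵇ length Y in ey
  ... | false | _ = inj₁ refl
  ... | true | false = inj₁ refl
  ... | true | true = inj₂ (≤ᵇ⇒≤ _ _ (subst T (sym ex) tt) , ≤ᵇ⇒≤ _ _ (subst T (sym ey) tt) , refl)

  LCE-in-range : ∀ k X Y x y → x ≤ length X → y ≤ length Y →
    LCE _≟A_ k X Y x (ℤ.+ y) ≡ Search.search k X Y x y ((length X ∸ x) ⊓ (length Y ∸ y))
  LCE-in-range k X Y x y x≤ y≤ with x ≤ᵇ length X in ex | y ≤ᵇ length Y in ey
  ... | false | _ = ⊥-elim (subst T ex (≤⇒≤ᵇ x≤))
  ... | true | false = ⊥-elim (subst T ey (≤⇒≤ᵇ y≤))
  ... | true | true = refl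

  common-prefix≤LCE₀ : ∀ X Y x y a → x ≤ length X → y ≤ length Y → a ≤ length (drop x X) →
    take a (drop x X) ≡ take a (drop y Y) → a ≤ LCE _≟A_ 0 X Y x (ℤ.+ y)
  common-prefix≤LCE₀ X Y x y a x≤ y≤ a≤X same =
    subst (a ≤_) (sym (LCE-in-range 0 X Y x y x≤ y≤))
      (Search.search-max 0 X Y x y _ a
        (⊓-glb (subst (a ≤_) (length-drop x X) a≤X) (subst (a ≤_) (length-drop y Y) a≤Y))
        (≤-reflexive (subst (λ P → hd (take a (drop x X)) P ≡ 0) same (hd-refl (take a (drop x X))))))
    where
    a≤Y : a ≤ length (drop y Y)
    a≤Y = m⊓n≡m⇒m≤n (trans (sym (length-take a (drop y Y)))
            (trans (cong length (sym same)) (trans (length-take a (drop x X)) (m≤n⇒m⊓n≡m a≤X))))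

  record Close (k : ℕ) (X Y : List A) (x y w : ℕ) : Set where
    field
      fitsX : w ≤ length (drop x X)
      fitsY : w ≤ length (drop y Y)
      hd≤k : hd (sub _≟A_ X x w) (sub _≟A_ Y y w) ≤ k

  LCE-witness : ∀ k X Y x z w → 0 < w → w ≤ LCE _≟A_ k X Y x z → ∃ λ y → z ≡ ℤ.+ y × Close k X Y x y w
  LCE-witness k X Y x ℤ.-[1+ _ ] w 0<w w≤ = ⊥-elim (<⇒≱ 0<w w≤)
  LCE-witness k X Y x (ℤ.+ y) w 0<w w≤ with LCE-cases k X Y x y
  ... | inj₁ zero-out = ⊥-elim (<⇒≱ 0<w (subst (w ≤_) zero-out w≤))
  ... | inj₂ (x≤ , y≤ , in-range) = y , refl , record
    { fitsX = subst (w ≤_) (sym (length-drop x X)) (≤-trans w≤m (m⊓n≤m _ _))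
    ; fitsY = subst (w ≤_) (sym (length-drop y Y)) (≤-trans w≤m (m⊓n≤n _ _))
    ; hd≤k = ≤-trans (hd-take-mono (drop x X) (drop y Y) w≤ℓ) (search-close m) }
    where
    open Search k X Y x y
    m = (length X ∸ x) ⊓ (length Y ∸ y)
    w≤ℓ : w ≤ search m
    w≤ℓ = subst (w ≤_) in-range w≤
    w≤m : w ≤ m
    w≤m = ≤-trans w≤ℓ (search-≤ m)

  module Suffixes (X Y : List A) where

    E : ℕ → ℕ → ℕ
    E x y = ed (drop x X) (drop y Y)

    drop-suc : ∀ n (L : List A) → drop 1 (drop n L) ≡ drop (suc n) L
    drop-suc n L = trans (drop-drop n 1 L) (cong (λ m → drop m L) (+-comm n 1))

    E-stepˣ : ∀ x y → E x y ≤ suc (E (suc x) y)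
    E-stepˣ x y =
      subst (λ R → E x y ≤ suc (ed R (drop y Y))) (drop-suc x X) (ed-dropˡ (drop x X) (drop y Y))

    E-diag : ∀ x y → E x y ≤ suc (E (suc x) (suc y))
    E-diag x y = subst₂ (λ R R′ → E x y ≤ suc (ed R R′)) (drop-suc x X) (drop-suc y Y)
                   (ed-drop-both (drop x X) (drop y Y))

    E-lipschitzʸ : ∀ x y y′ → E x y ≤ E x y′ + ∣ y - y′ ∣
    E-lipschitzʸ x = unit-steps⇒lipschitz (E x) down up
      where
      down : ∀ n → E x n ≤ suc (E x (suc n))
      down n = subst (λ R → E x n ≤ suc (ed (drop x X) R)) (drop-suc n Y)
                 (ed-dropʳ (drop x X) (drop n Y))
      up : ∀ n → E x (suc n) ≤ suc (E x n)
      up n = subst (λ R → ed (drop x X) R ≤ suc (E x n)) (drop-suc n Y)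
               (ed-undropʳ (drop x X) (drop n Y))

    E-advance : ∀ x y y′ → E x y ≤ suc (E (suc x) y′ + ∣ suc y - y′ ∣)
    E-advance x y y′ with ≤-total y′ y
    ... | inj₁ y′≤y = ≤-trans (E-stepˣ x y) (s≤s (≤-trans (E-lipschitzʸ (suc x) y y′)
                         (+-monoʳ-≤ (E (suc x) y′) (∣-∣-suc-mono y′≤y))))
    ... | inj₂ y≤y′ = ≤-trans (E-diag x y) (s≤s (E-lipschitzʸ (suc x) (suc y) y′))

    E-transition : ∀ {k} x y x′ y′ → x′ ≡ x ⊎ x′ ≡ suc x → ∣ x - y ∣ ≤ k → ∣ x′ - y′ ∣ ≤ k →
      E x y ≤ E x′ y′ + suc (k + k)
    E-transition {k} x y x′ y′ (inj₁ refl) xy≤k x′y′≤k = begin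
      E x y                      ≤⟨ E-lipschitzʸ x y y′ ⟩
      E x y′ + ∣ y - y′ ∣         ≤⟨ +-monoʳ-≤ (E x y′) (∣-∣-triangle y x y′) ⟩
      E x y′ + (∣ y - x ∣ + ∣ x - y′ ∣) ≤⟨ +-monoʳ-≤ (E x y′) (+-mono-≤ (band-sym x y xy≤k) x′y′≤k) ⟩
      E x y′ + (k + k)           ≤⟨ +-monoʳ-≤ (E x y′) (n≤1+n _) ⟩
      E x y′ + suc (k + k)       ∎
      where open ≤-Reasoning
    E-transition {k} x y x′ y′ (inj₂ refl) xy≤k x′y′≤k = begin
      E x y                               ≤⟨ E-advance x y y′ ⟩
      suc (E x′ y′ + ∣ suc y - y′ ∣)       ≡⟨ +-suc (E x′ y′) _ ⟨
      E x′ y′ + suc ∣ suc y - y′ ∣         ≤⟨ +-monoʳ-≤ (E x′ y′) (s≤s (∣-∣-triangle (suc y) x′ y′)) ⟩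
      E x′ y′ + suc (∣ y - x ∣ + ∣ x′ - y′ ∣)
                                          ≤⟨ +-monoʳ-≤ (E x′ y′) (s≤s (+-mono-≤ (band-sym x y xy≤k) x′y′≤k)) ⟩
      E x′ y′ + suc (k + k)                ∎
      where open ≤-Reasoning

  module Procedure (k : ℕ) (X Y : List A) (O : ℕ → ℕ → ℤ → ℕ)
                   (valid : ValidOracle _≟A_ k X Y O) where
    open Suffixes X Y

    query : ℕ → ℕ → ℤ
    query x j = (ℤ.+ x ℤ.+ ℤ.+ j) ℤ.- ℤ.+ k

    query-hits : ∀ {x y j} → x + j ≡ y + k → query x j ≡ ℤ.+ y
    query-hits {x} {y} {j} e = trans ([+m]-[+n]≡m⊖n (x + j) k) (trans (cong (_⊖ k) e) (+⊖-cancel y k))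

    query-lands : ∀ {x y j} → query x j ≡ ℤ.+ y → x + j ≡ y + k
    query-lands {x} {y} {j} e = ⊖≡+⇒ (trans (sym ([+m]-[+n]≡m⊖n (x + j) k)) e)

    2k≡k+k : 2 * k ≡ k + k
    2k≡k+k = cong (k +_) (+-identityʳ k)

    reach : ℕ → ℕ → ℕ
    reach i x = maxDelta _≟A_ k O i x

    -- Every band point is queried, so a common prefix there is no longer than
    -- the extension.
    common-prefix≤reach : ∀ i x y a → x ≤ length X → y ≤ length Y → ∣ x - y ∣ ≤ k →
      a ≤ length (drop x X) → take a (drop x X) ≡ take a (drop y Y) → a ≤ reach i x
    common-prefix≤reach i x y a x≤ y≤ band a≤ same = begin
      a                                ≤⟨ common-prefix≤LCE₀ X Y x y a x≤ y≤ a≤ same ⟩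
      LCE _≟A_ 0 X Y x (ℤ.+ y)          ≡⟨ cong (LCE _≟A_ 0 X Y x) (query-hits {x} {y} {j} hits) ⟨
      LCE _≟A_ 0 X Y x (query x j)      ≤⟨ proj₁ (valid i x (query x j)) ⟩
      O i x (query x j)                ≤⟨ fold⊔-upper (λ j′ → O i x (query x j′)) (upTo (suc (2 * k))) (∈-upTo⁺ j<) ⟩
      reach i x                        ∎
      where
      open ≤-Reasoning
      j = y + k ∸ x
      hits : x + j ≡ y + k
      hits = proj₁ (band⇒offset x y band)
      j< : j < suc (2 * k)
      j< = s≤s (subst (j ≤_) (sym 2k≡k+k) (proj₂ (band⇒offset x y band)))

    -- An extension of length w from x: a band point (x, y) from which w
    -- characters of both strings can be aligned at cost ≤ k.
    record Extension (x w : ℕ) : Set where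
      field
        y : ℕ
        band : ∣ x - y ∣ ≤ k
        fits : x + w ≤ length X
        cost : E x y ≤ E (x + w) (y + w) + k

      band-after : ∣ x + w - y + w ∣ ≤ k
      band-after = subst (_≤ k) (sym (∣-∣-shift x y w)) band

    empty-extension : ∀ x → x ≤ length X → Extension x 0
    empty-extension x x≤ = record
      { y = x
      ; band = subst (_≤ k) (sym (∣n-n∣≡0 x)) z≤n
      ; fits = subst (_≤ length X) (sym (+-identityʳ x)) x≤
      ; cost = subst (λ z → E x x ≤ E z z + k) (sym (+-identityʳ x)) (m≤m+n (E x x) k) }

    query-extension : ∀ i x j → x ≤ length X → j ≤ k + k → Extension x (O i x (query x j))
    query-extension i x j x≤ j≤ with O i x (query x j) | proj₂ (valid i x (query x j))
    ... | zero | _ = empty-extension x x≤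
    ... | suc w′ | w≤LCE with LCE-witness k X Y x (query x j) (suc w′) (s≤s z≤n) w≤LCE
    ...   | y , lands , c = record
      { y = y
      ; band = offset⇒band {x} {y} {j} (query-lands {x} {y} {j} lands) j≤
      ; fits = ≤-trans (+-monoʳ-≤ x (subst (w ≤_) (length-drop x X) fitsX)) (≤-reflexive (m+[n∸m]≡n x≤))
      ; cost = subst₂ (λ R R′ → E x y ≤ ed R R′ + k) (drop-drop x w X) (drop-drop y w Y)
                 (≤-trans (ed-≤-prefix-hd w (drop x X) (drop y Y) fitsX fitsY) (+-monoʳ-≤ _ hd≤k)) }
      where
      open Close c
      w = suc w′

    reach-extension : ∀ i x → x ≤ length X → Extension x (reach i x)
    reach-extension i x x≤ with fold⊔-attained (λ j → O i x (query x j)) (upTo (suc (2 * k)))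
    ... | inj₁ none = subst (Extension x) (sym none) (empty-extension x x≤)
    ... | inj₂ (j , j∈ , attained) = subst (Extension x) (sym attained) (query-extension i x j x≤ j≤)
      where
      j≤ : j ≤ k + k
      j≤ = subst (j ≤_) 2k≡k+k (≤-pred (∈-upTo⁻ j∈))

    start : ℕ → ℕ
    start = d′ _≟A_ k X O

    end : ℕ → ℕ
    end = dd _≟A_ k X O

    start≤ : ∀ i → start i ≤ length X
    start≤ zero = z≤n
    start≤ (suc i) = m⊓n≤m _ _

    extension : ∀ i → Extension (start i) (reach i (start i))
    extension i = reach-extension i (start i) (start≤ i)

    end≤ : ∀ i → end i ≤ length X
    end≤ i = Extension.fits (extension i)

    start-done⇒end-done : ∀ i → start i ≡ length X → end i ≡ length X
    start-done⇒end-done i e = ≤-antisym (end≤ i) (subst (_≤ end i) e (m≤m+n (start i) _))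

    end-done⇒next-done : ∀ i → end i ≡ length X → start (suc i) ≡ length X
    end-done⇒next-done i e = m≤n⇒m⊓n≡m (≤-trans (≤-reflexive (sym e)) (m≤m+n (end i) 1))

    end-short⇒next-step : ∀ i → end i < length X → start (suc i) ≡ suc (end i)
    end-short⇒next-step i lt =
      trans (m≥n⇒m⊓n≡n (≤-trans (≤-reflexive (+-comm (end i) 1)) lt)) (+-comm (end i) 1)

    next-start : ∀ i → start (suc i) ≡ end i ⊎ start (suc i) ≡ suc (end i)
    next-start i with m≤n⇒m<n∨m≡n (end≤ i)
    ... | inj₁ lt = inj₂ (end-short⇒next-step i lt)
    ... | inj₂ e = inj₁ (trans (end-done⇒next-done i e) (sym e))

    -- Completeness invariant: a point (x, y) whose remaining edit distance
    -- still leaves room for the i rounds played so far and for the offset.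
    record OnTrack (i x : ℕ) : Set where
      field
        y : ℕ
        y≤ : y ≤ length Y
        budget : E x y + i ≤ k
        band : E x y + ∣ x - y ∣ ≤ k

    -- Cutting an optimal alignment of the suffixes after a prefix of X[x..)
    -- that is not matched exactly consumes at least one unit of budget.
    advance : ∀ {i x} (t : OnTrack i x) a → a ≤ length (drop x X) →
      take a (drop x X) ≢ take a (drop (OnTrack.y t) Y) → OnTrack (suc i) (x + a)
    advance {i} {x} t a a≤ mismatch = record
      { y = y + b
      ; y≤ = ≤-trans (+-monoʳ-≤ y (subst (b ≤_) (length-drop y Y) b≤)) (≤-reflexive (m+[n∸m]≡n y≤))
      ; budget = subst (λ e → e + suc i ≤ k) E′≡
          (≤-trans (≤-reflexive (+-suc E′ i)) (≤-trans (+-monoˡ-≤ i (strict mismatch)) budget))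
      ; band = subst (λ e → e + ∣ x + a - y + b ∣ ≤ k) E′≡ band′ }
      where
      open OnTrack t
      open Cut (cut (drop x X) (drop y Y) a a≤)
      E′ = ed (drop a (drop x X)) (drop b (drop y Y))
      E′≡ : E′ ≡ E (x + a) (y + b)
      E′≡ = cong₂ ed (drop-drop x a X) (drop-drop y b Y)
      band′ : E′ + ∣ x + a - y + b ∣ ≤ k
      band′ = begin
        E′ + ∣ x + a - y + b ∣        ≤⟨ +-monoʳ-≤ E′ (∣-∣-+ x y a b) ⟩
        E′ + (∣ x - y ∣ + ∣ a - b ∣)  ≡⟨ cong (E′ +_) (+-comm ∣ x - y ∣ ∣ a - b ∣) ⟩
        E′ + (∣ a - b ∣ + ∣ x - y ∣)  ≡⟨ +-assoc E′ ∣ a - b ∣ ∣ x - y ∣ ⟨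
        E′ + ∣ a - b ∣ + ∣ x - y ∣    ≤⟨ +-monoˡ-≤ ∣ x - y ∣ bound ⟩
        E x y + ∣ x - y ∣             ≤⟨ band ⟩
        k                            ∎
        where open ≤-Reasoning

    -- One round: either the end of X is reached, or the invariant advances,
    -- since the extension stops before a mismatch of the on-track diagonal.
    round : ∀ i → OnTrack i (start i) → end i ≡ length X ⊎ OnTrack (suc i) (start (suc i))
    round i t with m≤n⇒m<n∨m≡n (end≤ i)
    ... | inj₂ done = inj₁ done
    ... | inj₁ short = inj₂ (subst (OnTrack (suc i)) next (advance t (suc w) a≤ mismatch))
      where
      open OnTrack t
      x = start i
      w = reach i x
      next : x + suc w ≡ start (suc i)
      next = trans (+-suc x w) (sym (end-short⇒next-step i short))
      a≤ : suc w ≤ length (drop x X)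
      a≤ = subst (suc w ≤_) (sym (length-drop x X))
             (m+n≤o⇒m≤o∸n (suc w) (subst (_≤ length X) (cong suc (+-comm x w)) short))
      mismatch : take (suc w) (drop x X) ≢ take (suc w) (drop y Y)
      mismatch same = 1+n≰n (common-prefix≤reach i x y (suc w) (start≤ i) y≤ (m+n≤o⇒n≤o _ band) a≤ same)

    on-track : ed X Y ≤ k → ∀ i → start i ≡ length X ⊎ OnTrack i (start i)
    on-track h zero = inj₂ (record { y = 0 ; y≤ = z≤n ; budget = h+0 ; band = h+0 })
      where
      h+0 : ed X Y + 0 ≤ k
      h+0 = subst (_≤ k) (sym (+-identityʳ _)) h
    on-track h (suc i) with on-track h i
    ... | inj₁ done = inj₁ (end-done⇒next-done i (start-done⇒end-done i done))
    ... | inj₂ t with round i t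
    ...   | inj₁ done = inj₁ (end-done⇒next-done i done)
    ...   | inj₂ t′ = inj₂ t′

    -- Completeness: if ED(X, Y) ≤ k then d_k = |X|, since the budget rules out
    -- a (k + 1)-st unfinished round.
    completeness : ed X Y ≤ k → end k ≡ length X
    completeness h with on-track h k
    ... | inj₁ done = start-done⇒end-done k done
    ... | inj₂ t with round k t
    ...   | inj₁ done = done
    ...   | inj₂ t′ = ⊥-elim (1+n≰n (m+n≤o⇒n≤o _ (OnTrack.budget t′)))

    -- Cost charged after round i: k for the first offset, then per round k
    -- for the extension and 2k + 1 for the transition to the next start.
    spent : ℕ → ℕ
    spent i = k + k + i * (3 * k + 1)

    -- Soundness invariant: the extensions found so far align X[0..dᵢ) with
    -- Y[0..y) at cost ≤ spent i, for a band point (dᵢ, y).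
    record Certified (i : ℕ) : Set where
      field
        y : ℕ
        band : ∣ end i - y ∣ ≤ k
        bound : ed X Y ≤ E (end i) y + spent i

    certified : ∀ i → Certified i
    certified zero = record { y = y + w ; band = band-after ; bound = bound }
      where
      w = reach 0 0
      open Extension (extension 0)
      bound : ed X Y ≤ E w (y + w) + spent 0
      bound = begin
        E 0 0                      ≤⟨ E-lipschitzʸ 0 0 y ⟩
        E 0 y + y                  ≤⟨ +-mono-≤ cost band ⟩
        E w (y + w) + k + k        ≡⟨ +-assoc (E w (y + w)) k k ⟩
        E w (y + w) + (k + k)      ≡⟨ cong (E w (y + w) +_) (+-identityʳ (k + k)) ⟨
        E w (y + w) + spent 0      ∎
        where open ≤-Reasoning
    certified (suc i) = record { y = y + w ; band = band-after ; bound = bound }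
      where
      open Certified (certified i) renaming (y to y₀; band to band₀; bound to bound₀)
      x = start (suc i)
      w = reach (suc i) x
      open Extension (extension (suc i))
      bound : ed X Y ≤ E (x + w) (y + w) + spent (suc i)
      bound = begin
        ed X Y                                        ≤⟨ bound₀ ⟩
        E (end i) y₀ + spent i                        ≤⟨ +-monoˡ-≤ (spent i) transition ⟩
        E x y + suc (k + k) + spent i                  ≤⟨ +-monoˡ-≤ (spent i) (+-monoˡ-≤ (suc (k + k)) cost) ⟩
        E (x + w) (y + w) + k + suc (k + k) + spent i  ≡⟨ charge (E (x + w) (y + w)) k i ⟩
        E (x + w) (y + w) + spent (suc i)             ∎
        where
        open ≤-Reasoning
        transition : E (end i) y₀ ≤ E x y + suc (k + k)
        transition = E-transition (end i) y₀ x y (next-start i) band₀ band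
        charge : ∀ e k i → e + k + suc (k + k) + (k + k + i * (3 * k + 1)) ≡
                           e + (k + k + suc i * (3 * k + 1))
        charge = solve-∀

    -- Soundness: if d_k = |X| and ||X| − |Y|| ≤ k, the certified alignment
    -- costs at most (3k + 5)k, the final jump to the end of Y at most 2k.
    soundness : end k ≡ length X → ∣ length X - length Y ∣ ≤ k → ed X Y ≤ (3 * k + 5) * k
    soundness done lengths = begin
      ed X Y                          ≤⟨ bound ⟩
      E (end k) y + spent k            ≤⟨ +-monoˡ-≤ (spent k) last ⟩
      k + k + spent k                  ≡⟨ total k ⟩
      (3 * k + 5) * k                  ∎
      where
      open ≤-Reasoning
      open Certified (certified k)
      total : ∀ k → k + k + (k + k + k * (3 * k + 1)) ≡ (3 * k + 5) * k
      total = solve-∀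
      last : E (end k) y ≤ k + k
      last = begin
        ed (drop (end k) X) (drop y Y) ≡⟨ cong (λ R → ed R (drop y Y)) X-consumed ⟩
        ed [] (drop y Y)               ≡⟨ length-drop y Y ⟩
        length Y ∸ y                   ≤⟨ m∸n≤∣m-n∣ (length Y) y ⟩
        ∣ length Y - y ∣                ≤⟨ ∣-∣-triangle (length Y) (length X) y ⟩
        ∣ length Y - length X ∣ + ∣ length X - y ∣
                                       ≤⟨ +-mono-≤ (band-sym (length X) (length Y) lengths) (subst (λ n → ∣ n - y ∣ ≤ k) done band) ⟩
        k + k                          ∎
        where
        X-consumed : drop (end k) X ≡ []
        X-consumed = trans (cong (λ n → drop n X) done) (drop-all (length X) X ≤-refl)

lemma3p1 : {A : Set} (_≟A_ : DecidableEquality A) (X Y : List A) (k : ℕ)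
    (O : ℕ → ℕ → ℤ → ℕ) → ValidOracle _≟A_ k X Y O →
    (ED _≟A_ X Y ≤ k → procedure _≟A_ k X Y O ≡ true) ×
    ((3 * k + 5) * k < ED _≟A_ X Y → procedure _≟A_ k X Y O ≡ false)
lemma3p1 _≟A_ X Y k O valid = accepts , rejects
  where
  open Procedure _≟A_ k X Y O valid

  -- the length test passes since ||X| − |Y|| ≤ ED, and completeness gives d_k = |X|
  accepts : ED _≟A_ X Y ≤ k → procedure _≟A_ k X Y O ≡ true
  accepts near
    rewrite Equivalence.to T-≡ (≤⇒≤ᵇ (≤-trans (length-diff≤ed _≟A_ X Y) near))
    = dec-true (end k ≟ length X) (completeness near)

  -- if the length test passes, d_k = |X| would contradict soundness
  rejects : (3 * k + 5) * k < ED _≟A_ X Y → procedure _≟A_ k X Y O ≡ false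
  rejects far with ∣ length X - length Y ∣ ≤ᵇ k in lengths
  ... | false = refl
  ... | true = dec-false (end k ≟ length X)
                 (λ done → <⇒≱ far (soundness done (≤ᵇ⇒≤ _ _ (subst T (sym lengths) tt))))
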